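{- Let $G$ be a graph and let $f=(V_1,V_2,\dots,V_{\ell})$ be a total dominator coloring of $G$, where $V_i$ is the set of vertices of color $i$. Let $I=\{i : |V_i|\leq \Delta(G)\}$. Then $V(G)=\bigcup_{i\in I} CN_G(V_i)$.
   Context: All graphs are finite, simple and undirected. A total dominator coloring (TDC) of a graph $G$ is a proper vertex coloring of $G$ in which each vertex of $G$ is adjacent to every vertex of some color class. $\Delta(G)$ is the maximum degree of $G$. For a set $V_i\subseteq V(G)$, a vertex $v$ is a common neighbor of $V_i$ if $v$ is adjacent to all vertices of $V_i$; the common neighborhood $CN_G(V_i)$ is the set of all common neighbors of $V_i$. -}

module Defs where

open import Data.Nat using (ℕ; _≤_; _⊔_)
open import Data.Fin using (Fin)
open import Data.Fin.Properties using (_≟_)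
open import Data.Bool using (Bool; true; false)
open import Data.List using (List; length; filter; foldr)
open import Data.List.Base using (allFin)
open import Data.Product using (Σ; ∃; _×_)
open import Relation.Binary.PropositionalEquality using (_≡_; _≢_)
open import Data.Bool.Properties using () renaming (_≟_ to _≟ᵇ_)
open import Relation.Nullary using (¬_)

record Graph (n : ℕ) : Set where
  field
    adj     : Fin n → Fin n → Bool
    symm    : ∀ u v → adj u v ≡ adj v u
    irrefl  : ∀ v → adj v v ≡ false

open Graph public

Adj : ∀ {n} → Graph n → Fin n → Fin n → Set
Adj G u v = adj G u v ≡ true

degree : ∀ {n} → Graph n → Fin n → ℕ
degree {n} G v = length (filter (λ w → adj G v w ≟ᵇ true) (allFin n))

Δ : ∀ {n} → Graph n → ℕ
Δ {n} G = foldr (λ v m → degree G v ⊔ m) 0 (allFin n)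

-- a colouring with ℓ colours: c v is the colour of v;
-- the colour class V_i = { v | c v ≡ i }
Colouring : ℕ → ℕ → Set
Colouring n ℓ = Fin n → Fin ℓ

classSize : ∀ {n ℓ} → Colouring n ℓ → Fin ℓ → ℕ
classSize {n} c i = length (filter (λ v → c v ≟ i) (allFin n))

CommonNeighbour : ∀ {n ℓ} → Graph n → Colouring n ℓ → Fin ℓ → Fin n → Set
CommonNeighbour G c i v = ∀ u → c u ≡ i → Adj G v u

ProperColouring : ∀ {n ℓ} → Graph n → Colouring n ℓ → Set
ProperColouring {n} {ℓ} G c =
  (∀ u v → Adj G u v → c u ≢ c v) × (∀ (i : Fin ℓ) → ∃ λ (v : Fin n) → c v ≡ i)

IsTDC : ∀ {n ℓ} → Graph n → Colouring n ℓ → Set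
IsTDC {n} {ℓ} G c =
  ProperColouring G c × (∀ (v : Fin n) → ∃ λ (i : Fin ℓ) → CommonNeighbour G c i v)

module Submission where

open import Defs
open import Data.Nat using (ℕ; _≤_; _⊔_)
open import Data.Nat.Properties using (≤-trans; m≤m⊔n; m≤n⊔m)
open import Data.Fin using (Fin)
open import Data.Product using (∃; _×_; _,_)
open import Data.List using (List; _∷_; foldr; allFin)
open import Data.List.Relation.Unary.Any using (here; there)
open import Data.List.Membership.Propositional using (_∈_)
open import Data.List.Membership.Propositional.Properties using (∈-allFin)
open import Data.List.Relation.Binary.Sublist.Propositional using (⊆-refl)
open import Data.List.Relation.Binary.Sublist.Heterogeneous.Properties
  using (length-mono-≤; ⊆-filter-Sublist)
open import Relation.Binary.PropositionalEquality using (refl)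

f≤foldr-⊔ : ∀ {A : Set} (f : A → ℕ) {x : A} {xs : List A} →
            x ∈ xs → f x ≤ foldr (λ y m → f y ⊔ m) 0 xs
f≤foldr-⊔ f {xs = y ∷ _} (here refl) = m≤m⊔n (f y) _
f≤foldr-⊔ f {xs = y ∷ _} (there x∈ys) = ≤-trans (f≤foldr-⊔ f x∈ys) (m≤n⊔m (f y) _)

degree≤Δ : ∀ {n} (G : Graph n) (v : Fin n) → degree G v ≤ Δ G
degree≤Δ G v = f≤foldr-⊔ (degree G) (∈-allFin v)

classSize≤degree : ∀ {n ℓ} (G : Graph n) (c : Colouring n ℓ) {i : Fin ℓ} {v : Fin n} →
                   CommonNeighbour G c i v → classSize c i ≤ degree G v
classSize≤degree {n} G c cn =
  length-mono-≤ (⊆-filter-Sublist _ _ (λ { refl → cn _ }) (⊆-refl {x = allFin n}))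

proposition1p4 : ∀ {n ℓ : ℕ} (G : Graph n) (c : Colouring n ℓ) → IsTDC G c →
    ∀ (v : Fin n) → ∃ λ (i : Fin ℓ) → (classSize c i ≤ Δ G) × CommonNeighbour G c i v
proposition1p4 G c (_ , dominates) v with dominates v
... | i , cn = i , ≤-trans (classSize≤degree G c cn) (degree≤Δ G v) , cn
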